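{- Let $G$ be a graph containing pairwise edge-disjoint connected subgraphs $G_1,G_2,G_3,G_4$ such that $H:=G_1\cup G_2$ and $K:=G_3\cup G_4$ are disjoint, and $G_1\cap G_2$ and $G_3\cap G_4$ are nonempty. Suppose $G$ contains the following six pairwise edge-disjoint paths: for $i=1,2$, a path $L_i^a$ between a vertex $a_i\in V(G_1)\setminus V(G_2)$ and a vertex $b_i\in V(G_2)\setminus V(G_1)$; for $i=1,2$, a path $L_i^c$ between a vertex $c_i\in V(G_3)\setminus V(G_4)$ and a vertex $d_i\in V(G_4)\setminus V(G_3)$; and paths $L_3,L_4$ such that either (a) $L_3$ and $L_4$ are both paths between $V(G_1\cap G_2)$ and $V(G_3\cap G_4)$, or (b) $L_3$ is a path between $V(G_1)$ and $V(G_4)$, $L_4$ is a path between $V(G_2)$ and $V(G_3)$, and $L_3\cup L_4$ is edge-disjoint from $H\cup K$. Suppose further that $G$ contains vertices $x$ and $y$, not contained in any $G_i$ nor in any of the six paths above, each of degree two, such that the neighbors of $x$ are $b_1$ and $b_2$ and the neighbors of $y$ are $c_1$ and $c_2$. Then $G$ contains two edge-disjoint $xy$-paths.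
   Context: Graphs are finite and loopless but may have multiple edges. A path "between" two vertex sets has one end in each set. -}

module Defs where

open import Data.Nat using (ℕ)
open import Data.Fin using (Fin)
open import Data.Fin.Subset using (Subset; _∈_; _∉_; _∩_; _∪_; Empty)
open import Data.Fin.Properties using (_≟_)
open import Data.Product using (Σ; ∃; _×_; _,_; proj₁; proj₂)
open import Data.Sum using (_⊎_)
open import Data.List using (List; []; _∷_; filter; length; allFin)
open import Data.List.Membership.Propositional renaming (_∈_ to _∈ₗ_)
open import Data.List.Relation.Unary.Unique.Propositional using (Unique)
open import Relation.Binary.PropositionalEquality using (_≡_; _≢_)
open import Relation.Nullary using (¬_)
open import Relation.Nullary.Decidable using (_⊎-dec_)

-- A finite loopless multigraph: vertices Fin n, edges Fin m, each edge
-- has two (distinct) ends.  Parallel edges are allowed.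
record Graph : Set where
  field
    n : ℕ
    m : ℕ
    ends : Fin m → Fin n × Fin n
    loopless : ∀ e → proj₁ (ends e) ≢ proj₂ (ends e)

module _ (G : Graph) where
  open Graph G

  Vertex : Set
  Vertex = Fin n

  Edge : Set
  Edge = Fin m

  Joins : Edge → Vertex → Vertex → Set
  Joins e u v = ends e ≡ (u , v) ⊎ ends e ≡ (v , u)

  Incident : Edge → Vertex → Set
  Incident e v = proj₁ (ends e) ≡ v ⊎ proj₂ (ends e) ≡ v

  degree : Vertex → ℕ
  degree v = length (filter (λ e → (proj₁ (ends e) ≟ v) ⊎-dec (proj₂ (ends e) ≟ v)) (allFin m))

  Adjacent : Vertex → Vertex → Set
  Adjacent u v = ∃ λ e → Joins e u v

  record Subgraph : Set where
    field
      V : Subset n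
      E : Subset m
      closed : ∀ e → e ∈ E → proj₁ (ends e) ∈ V × proj₂ (ends e) ∈ V

  open Subgraph public

  data Walk : Vertex → Vertex → Set where
    [_] : (v : Vertex) → Walk v v
    step : ∀ {u v w} (e : Edge) → Joins e u v → Walk v w → Walk u w

  verticesW : ∀ {u v} → Walk u v → List Vertex
  verticesW [ v ] = v ∷ []
  verticesW (step {u} e _ W) = u ∷ verticesW W

  edgesW : ∀ {u v} → Walk u v → List Edge
  edgesW [ v ] = []
  edgesW (step e _ W) = e ∷ edgesW W

  record Path (u v : Vertex) : Set where
    constructor path
    field
      walk : Walk u v
      noRepeat : Unique (verticesW walk)

  vertices : ∀ {u v} → Path u v → List Vertex
  vertices P = verticesW (Path.walk P)

  edges : ∀ {u v} → Path u v → List Edge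
  edges P = edgesW (Path.walk P)

  record SomePath : Set where
    constructor somePath
    field
      start : Vertex
      end : Vertex
      thePath : Path start end

  open SomePath public

  verticesS : SomePath → List Vertex
  verticesS L = vertices (thePath L)

  edgesS : SomePath → List Edge
  edgesS L = edges (thePath L)

  Between : SomePath → Subset n → Subset n → Set
  Between L A B = (start L ∈ A × end L ∈ B) ⊎ (start L ∈ B × end L ∈ A)

  Connected : Subgraph → Set
  Connected S = (∃ λ v → v ∈ V S)
    × (∀ u v → u ∈ V S → v ∈ V S →
         Σ (Path u v) λ P → ∀ e → e ∈ₗ edges P → e ∈ E S)

  EdgeDisjointSub : Subgraph → Subgraph → Set
  EdgeDisjointSub S T = Empty (E S ∩ E T)

  EdgeDisjointList : List Edge → List Edge → Set
  EdgeDisjointList xs ys = ∀ e → e ∈ₗ xs → ¬ (e ∈ₗ ys)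

{-# OPTIONS --safe #-}
-- By Menger's theorem for two edge-disjoint paths it suffices that no single edge h separates
-- x from y.  In G − h the degree-two vertex x still reaches b₁ or b₂, hence all of G₂ if
-- h ∉ E(G₂), and then all of G₁ as well if h ∉ E(G₁), through a vertex of G₁ ∩ G₂.  If h ∈ E(G₂),
-- both edges at x survive and h misses one of the edge-disjoint paths L₁ᵃ, L₂ᵃ, which leads from
-- b₁ or b₂ into G₁.  So x reaches every Gᵢ (i = 1, 2) whose edges avoid h, in particular all of
-- G₁ ∩ G₂; symmetrically for y, G₃ and G₄.  Finally some path among L₃, L₄ avoids h and joins
-- what x reaches to what y reaches: in case (a) either one not containing h, in case (b) L₃ when
-- h avoids G₁, G₄ and L₃, and L₄ otherwise, since then h avoids G₂, G₃ and L₄.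
module Submission where

open import Defs
open import Data.Fin.Subset using (_∈_; _∉_; _∩_; _∪_; _─_; Empty; Nonempty)
open import Data.Product using (Σ; ∃; _×_; _,_)
open import Data.Sum using (_⊎_)
open import Data.List.Membership.Propositional using () renaming (_∈_ to _∈ₗ_; _∉_ to _∉ₗ_)
open import Relation.Binary.PropositionalEquality using (_≡_)

open import Data.Empty using (⊥-elim)
open import Data.Fin.Properties using (_≟_)
open import Data.Fin.Subset using (Subset)
open import Data.Fin.Subset.Properties using (x∈p∩q⁻; x∈p∩q⁺; p⊆p∪q; q⊆p∪q; p─q⊆p)
  renaming (_∈?_ to _∈ˢ?_)
open import Data.List using (List; []; _∷_; _++_; length; allFin)
import Data.List.Membership.DecPropositional as DecMembership
open import Data.List.Membership.Propositional.Properties using (∈-++⁻; ∈-filter⁻)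
open import Data.List.Relation.Binary.Subset.Propositional using () renaming (_⊆_ to _⊆ₗ_)
open import Data.List.Relation.Unary.All.Properties using (¬Any⇒All¬)
open import Data.List.Relation.Unary.All using ([]; _∷_)
open import Data.List.Relation.Unary.AllPairs using ([]; _∷_; tail)
open import Data.List.Relation.Unary.Any using (here; there)
open import Data.List.Relation.Unary.Unique.Propositional using (Unique)
open import Data.List.Relation.Unary.Unique.Propositional.Properties
  using (allFin⁺; filter⁺; Unique[x∷xs]⇒x∉xs)
open import Data.Nat using (_≤_; s≤s)
open import Data.Nat.Properties using (≤-reflexive)
open import Data.Product using (proj₁; proj₂)
open import Data.Sum using (inj₁; inj₂; [_,_]′; map)
open import Data.Unit using (⊤)
open import Relation.Binary.Definitions using (DecidableEquality)
open import Relation.Binary.PropositionalEquality using (_≢_; refl; sym; trans; cong; subst)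
open import Relation.Nullary using (¬_; Dec; yes; no)
open import Relation.Nullary.Decidable using (_⊎-dec_)

∉-∪⁻ : ∀ {n x} {p q : Subset n} → x ∉ p ∪ q → x ∉ p × x ∉ q
∉-∪⁻ {q = q} x∉p∪q = (λ x∈p → x∉p∪q (p⊆p∪q q x∈p)) , (λ x∈q → x∉p∪q (q⊆p∪q _ q x∈q))

∉-∪₄⁻ : ∀ {n x} {p q r s : Subset n} → x ∉ p ∪ q ∪ r ∪ s → x ∉ p × x ∉ q × x ∉ r × x ∉ s
∉-∪₄⁻ x∉ = let x∉p , x∉qrs = ∉-∪⁻ x∉ ; x∉q , x∉rs = ∉-∪⁻ x∉qrs in x∉p , x∉q , ∉-∪⁻ x∉rs

module _ {A : Set} (_≟ᴬ_ : DecidableEquality A) where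

  Unique-≥2⇒∃≢ : ∀ {xs : List A} → Unique xs → 2 ≤ length xs → ∀ a → ∃ λ b → b ∈ₗ xs × b ≢ a
  Unique-≥2⇒∃≢ {_ ∷ []} _ (s≤s ())
  Unique-≥2⇒∃≢ {b ∷ c ∷ _} ((b≢c ∷ _) ∷ _) _ a with b ≟ᴬ a
  ... | no b≢a = b , here refl , b≢a
  ... | yes refl = c , there (here refl) , λ c≡b → b≢c (sym c≡b)

module _ (G : Graph) where
  open Graph G
  open DecMembership {A = Vertex G} _≟_ using () renaming (_∈?_ to _∈ᵛ?_)
  open DecMembership {A = Edge G} _≟_ using () renaming (_∈?_ to _∈ᵉ?_)

  EdgeDisjointList-sym : ∀ {xs ys} → EdgeDisjointList G xs ys → EdgeDisjointList G ys xs
  EdgeDisjointList-sym xs#ys e e∈ys e∈xs = xs#ys e e∈xs e∈ys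

  EdgeDisjointList-mono : ∀ {xs ys xs′ ys′} → xs′ ⊆ₗ xs → ys′ ⊆ₗ ys →
    EdgeDisjointList G xs ys → EdgeDisjointList G xs′ ys′
  EdgeDisjointList-mono xs′⊆xs ys′⊆ys xs#ys e e∈xs′ e∈ys′ = xs#ys e (xs′⊆xs e∈xs′) (ys′⊆ys e∈ys′)

  joins-sym : ∀ {e u v} → Joins G e u v → Joins G e v u
  joins-sym (inj₁ eq) = inj₂ eq
  joins-sym (inj₂ eq) = inj₁ eq

  joins-functional : ∀ {e u v w} → Joins G e u v → Joins G e u w → v ≡ w
  joins-functional (inj₁ p) (inj₁ q) = cong proj₂ (trans (sym p) q)
  joins-functional (inj₁ p) (inj₂ q) = trans (cong proj₂ (trans (sym p) q)) (cong proj₁ (trans (sym p) q))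
  joins-functional (inj₂ p) (inj₁ q) = trans (cong proj₁ (trans (sym p) q)) (cong proj₂ (trans (sym p) q))
  joins-functional (inj₂ p) (inj₂ q) = cong proj₁ (trans (sym p) q)

  joins⇒incident : ∀ {e u v} → Joins G e u v → Incident G e u
  joins⇒incident (inj₁ eq) = inj₁ (cong proj₁ eq)
  joins⇒incident (inj₂ eq) = inj₂ (cong proj₂ eq)

  incident⇒joins : ∀ {e u} → Incident G e u → ∃ λ v → Joins G e u v
  incident⇒joins {e} (inj₁ eq) = proj₂ (ends e) , inj₁ (cong (_, proj₂ (ends e)) eq)
  incident⇒joins {e} (inj₂ eq) = proj₁ (ends e) , inj₂ (cong (proj₁ (ends e) ,_) eq)

  incident⇒endpoint : ∀ {e u v w} → Joins G e u v → Incident G e w → w ≡ u ⊎ w ≡ v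
  incident⇒endpoint (inj₁ eq) (inj₁ p) = inj₁ (trans (sym p) (cong proj₁ eq))
  incident⇒endpoint (inj₁ eq) (inj₂ p) = inj₂ (trans (sym p) (cong proj₂ eq))
  incident⇒endpoint (inj₂ eq) (inj₁ p) = inj₂ (trans (sym p) (cong proj₁ eq))
  incident⇒endpoint (inj₂ eq) (inj₂ p) = inj₁ (trans (sym p) (cong proj₂ eq))

  incident⇒∈V : ∀ {e u} (S : Subgraph G) → e ∈ E S → Incident G e u → u ∈ V S
  incident⇒∈V S e∈S (inj₁ eq) = subst (_∈ V S) eq (proj₁ (closed S _ e∈S))
  incident⇒∈V S e∈S (inj₂ eq) = subst (_∈ V S) eq (proj₂ (closed S _ e∈S))

  _++ʷ_ : ∀ {u v w} → Walk G u v → Walk G v w → Walk G u w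
  [ _ ] ++ʷ B = B
  step e j A ++ʷ B = step e j (A ++ʷ B)

  edgesW-++ʷ : ∀ {u v w} (A : Walk G u v) (B : Walk G v w) →
    edgesW G (A ++ʷ B) ≡ edgesW G A ++ edgesW G B
  edgesW-++ʷ [ _ ] B = refl
  edgesW-++ʷ (step e _ A) B = cong (e ∷_) (edgesW-++ʷ A B)

  ∈-edgesW-++ʷ⁻ : ∀ {u v w e} (A : Walk G u v) (B : Walk G v w) →
    e ∈ₗ edgesW G (A ++ʷ B) → e ∈ₗ edgesW G A ⊎ e ∈ₗ edgesW G B
  ∈-edgesW-++ʷ⁻ A B e∈ = ∈-++⁻ (edgesW G A) (subst (_ ∈ₗ_) (edgesW-++ʷ A B) e∈)

  reverseʷ : ∀ {u v} → Walk G u v → Walk G v u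
  reverseʷ [ v ] = [ v ]
  reverseʷ (step {u} e j W) = reverseʷ W ++ʷ step e (joins-sym j) [ u ]

  edgesW-reverseʷ : ∀ {u v} (W : Walk G u v) → edgesW G (reverseʷ W) ⊆ₗ edgesW G W
  edgesW-reverseʷ (step {u} e j W) e′∈ with ∈-edgesW-++ʷ⁻ (reverseʷ W) (step e (joins-sym j) [ u ]) e′∈
  ... | inj₁ e′∈W = there (edgesW-reverseʷ W e′∈W)
  ... | inj₂ (here refl) = here refl

  source∈verticesW : ∀ {u v} (W : Walk G u v) → u ∈ₗ verticesW G W
  source∈verticesW [ v ] = here refl
  source∈verticesW (step _ _ _) = here refl

  target∈verticesW : ∀ {u v} (W : Walk G u v) → v ∈ₗ verticesW G W
  target∈verticesW [ v ] = here refl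
  target∈verticesW (step _ _ W) = there (target∈verticesW W)

  incident⇒∈verticesW : ∀ {u v e w} (W : Walk G u v) → e ∈ₗ edgesW G W → Incident G e w →
    w ∈ₗ verticesW G W
  incident⇒∈verticesW (step e j W) (here refl) inc with incident⇒endpoint j inc
  ... | inj₁ refl = here refl
  ... | inj₂ refl = there (source∈verticesW W)
  incident⇒∈verticesW (step _ _ W) (there e∈W) inc = there (incident⇒∈verticesW W e∈W inc)

  suffix : ∀ {u v w} (W : Walk G u v) → w ∈ₗ verticesW G W →
    Σ (Walk G w v) λ W′ → edgesW G W′ ⊆ₗ edgesW G W × (Unique (verticesW G W) → Unique (verticesW G W′))
  suffix [ v ] (here refl) = [ v ] , (λ e∈ → e∈) , (λ U → U)
  suffix (step e j W) (here refl) = step e j W , (λ e∈ → e∈) , (λ U → U)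
  suffix (step e j W) (there w∈W) =
    let W′ , W′⊆W , unique = suffix W w∈W
    in W′ , (λ e∈ → there (W′⊆W e∈)) , λ U → unique (tail U)

  NoReturn : ∀ {u v} → Walk G u v → Set
  NoReturn [ _ ] = ⊤
  NoReturn (step {u} _ _ W) = u ∉ₗ verticesW G W

  lastSuffix : ∀ {u v w} (W : Walk G u v) → w ∈ₗ verticesW G W →
    Σ (Walk G w v) λ W′ → edgesW G W′ ⊆ₗ edgesW G W × NoReturn W′
  lastSuffix [ v ] (here refl) = [ v ] , (λ e∈ → e∈) , _
  lastSuffix {w = w} (step e j W) w∈ with w ∈ᵛ? verticesW G W | w∈
  ... | yes w∈W | _ = let W′ , W′⊆W , noReturn = lastSuffix W w∈W
                      in W′ , (λ e∈ → there (W′⊆W e∈)) , noReturn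
  ... | no w∉W | here refl = step e j W , (λ e∈ → e∈) , w∉W
  ... | no w∉W | there w∈W = ⊥-elim (w∉W w∈W)

  walk⇒path : ∀ {u v} (W : Walk G u v) → Σ (Path G u v) λ P → edges G P ⊆ₗ edgesW G W
  walk⇒path [ v ] = path [ v ] ([] ∷ []) , λ ()
  walk⇒path (step {u} e j W) with walk⇒path W
  ... | path P U , P⊆W with u ∈ᵛ? verticesW G P
  ...   | yes u∈P = let P′ , P′⊆P , unique = suffix P u∈P
                    in path P′ (unique U) , λ e∈ → there (P⊆W (P′⊆P e∈))
  ...   | no u∉P = path (step e j P) (¬Any⇒All¬ _ u∉P ∷ U) ,
                   λ { (here refl) → here refl ; (there e∈P) → there (P⊆W e∈P) }

  Reaches : Edge G → Vertex G → Vertex G → Set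
  Reaches h u v = Σ (Walk G u v) λ W → h ∉ₗ edgesW G W

  Reaches-sym : ∀ {h u v} → Reaches h u v → Reaches h v u
  Reaches-sym (W , h∉W) = reverseʷ W , λ h∈ → h∉W (edgesW-reverseʷ W h∈)

  Reaches-trans : ∀ {h u v w} → Reaches h u v → Reaches h v w → Reaches h u w
  Reaches-trans (A , h∉A) (B , h∉B) = A ++ʷ B , λ h∈ → [ h∉A , h∉B ]′ (∈-edgesW-++ʷ⁻ A B h∈)

  edge⇒Reaches : ∀ {h e u v} → Joins G e u v → e ≢ h → Reaches h u v
  edge⇒Reaches {e = e} {v = v} j e≢h = step e j [ v ] , λ { (here h≡e) → e≢h (sym h≡e) }

  EdgeDisjointWalks : Vertex G → Vertex G → Set
  EdgeDisjointWalks s t =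
    Σ (Walk G s t) λ A → Σ (Walk G s t) λ B → EdgeDisjointList G (edgesW G A) (edgesW G B)

  firstVisit : (S : Vertex G → Set) → (∀ v → Dec (S v)) → ∀ {u v} (W : Walk G u v) → S v →
    ∃ λ w → S w × Σ (Walk G u w) λ W′ → edgesW G W′ ⊆ₗ edgesW G W
      × (∀ {e} → e ∈ₗ edgesW G W′ → ∃ λ z → Incident G e z × ¬ S z)
  firstVisit S S? [ v ] v∈S = v , v∈S , [ v ] , (λ ()) , λ ()
  firstVisit S S? (step {u} e j W) v∈S with S? u
  ... | yes u∈S = u , u∈S , [ u ] , (λ ()) , λ ()
  ... | no u∉S = let w , w∈S , W′ , W′⊆W , leaves = firstVisit S S? W v∈S
                 in w , w∈S , step e j W′ ,
                    (λ { (here refl) → here refl ; (there e∈) → there (W′⊆W e∈) }) ,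
                    λ { (here refl) → u , joins⇒incident j , u∉S ; (there e∈) → leaves e∈ }

  leaving⇒EdgeDisjoint : ∀ {u v a b} (S : Vertex G → Set) (R : Walk G u v) →
    (∀ {e} → e ∈ₗ edgesW G R → ∃ λ z → Incident G e z × ¬ S z) →
    (W : Walk G a b) → (∀ {z} → z ∈ₗ verticesW G W → S z) →
    EdgeDisjointList G (edgesW G R) (edgesW G W)
  leaving⇒EdgeDisjoint S R leaves W W⊆S e e∈R e∈W =
    let z , inc , z∉S = leaves e∈R in z∉S (W⊆S (incident⇒∈verticesW W e∈W inc))

  -- The induction step of Menger's theorem along an s–t path.  If s lies on neither of the
  -- edge-disjoint s′–t walks A, B, follow the s–t walk avoiding g = ss′ to its first vertex w on
  -- A or B, say on A: that walk up to w followed by A from w, and g followed by B, are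
  -- edge-disjoint.
  module _ {s s′ t : Vertex G} {g : Edge G} (g-joins : Joins G g s s′) where

    reroute : ∀ {w} (A B : Walk G s′ t) → EdgeDisjointList G (edgesW G A) (edgesW G B) →
      s ∉ₗ verticesW G A → (R : Walk G s w) → g ∉ₗ edgesW G R →
      EdgeDisjointList G (edgesW G R) (edgesW G B) → w ∈ₗ verticesW G A → EdgeDisjointWalks s t
    reroute A B A#B s∉A R g∉R R#B w∈A with suffix A w∈A
    ... | A′ , A′⊆A , _ = R ++ʷ A′ , step g g-joins B , disjoint
      where
      disjoint : EdgeDisjointList G (edgesW G (R ++ʷ A′)) (g ∷ edgesW G B)
      disjoint e e∈ e∈gB with ∈-edgesW-++ʷ⁻ R A′ e∈ | e∈gB
      ... | inj₁ e∈R | here refl = g∉R e∈R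
      ... | inj₁ e∈R | there e∈B = R#B e e∈R e∈B
      ... | inj₂ e∈A′ | here refl = s∉A (incident⇒∈verticesW A (A′⊆A e∈A′) (joins⇒incident g-joins))
      ... | inj₂ e∈A′ | there e∈B = A#B e (A′⊆A e∈A′) e∈B

    extend-avoiding : Reaches g s t → (A B : Walk G s′ t) → EdgeDisjointList G (edgesW G A) (edgesW G B) →
      s ∉ₗ verticesW G A → s ∉ₗ verticesW G B → EdgeDisjointWalks s t
    extend-avoiding (R , g∉R) A B A#B s∉A s∉B
      with firstVisit OnAorB OnAorB? R (inj₁ (target∈verticesW A))
      where
      OnAorB : Vertex G → Set
      OnAorB v = v ∈ₗ verticesW G A ⊎ v ∈ₗ verticesW G B
      OnAorB? : ∀ v → Dec (OnAorB v)
      OnAorB? v = (v ∈ᵛ? verticesW G A) ⊎-dec (v ∈ᵛ? verticesW G B)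
    ... | w , inj₁ w∈A , R′ , R′⊆R , leaves =
      reroute A B A#B s∉A R′ (λ g∈ → g∉R (R′⊆R g∈)) (leaving⇒EdgeDisjoint _ R′ leaves B inj₂) w∈A
    ... | w , inj₂ w∈B , R′ , R′⊆R , leaves =
      reroute B A (EdgeDisjointList-sym A#B) s∉B R′ (λ g∈ → g∉R (R′⊆R g∈))
        (leaving⇒EdgeDisjoint _ R′ leaves A inj₁) w∈B

    -- Leave A at its last visit to s; if it does so along g, the rest of A misses s.
    extend-visiting-one : Reaches g s t → (A B : Walk G s′ t) → EdgeDisjointList G (edgesW G A) (edgesW G B) →
      s ∈ₗ verticesW G A → s ∉ₗ verticesW G B → EdgeDisjointWalks s t
    extend-visiting-one R A B A#B s∈A s∉B with lastSuffix A s∈A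
    ... | [ _ ] , _ , _ = [ s ] , [ s ] , λ _ ()
    ... | step e j A′ , eA′⊆A , s∉A′ with e ≟ g
    ...   | no e≢g = step e j A′ , step g g-joins B , disjoint
      where
      disjoint : EdgeDisjointList G (e ∷ edgesW G A′) (g ∷ edgesW G B)
      disjoint _ (here refl) (here refl) = e≢g refl
      disjoint _ (there e∈A′) (here refl) = s∉A′ (incident⇒∈verticesW A′ e∈A′ (joins⇒incident g-joins))
      disjoint e′ e′∈eA′ (there e′∈B) = A#B e′ (eA′⊆A e′∈eA′) e′∈B
    ...   | yes refl with joins-functional j g-joins
    ...     | refl =
      extend-avoiding R A′ B (EdgeDisjointList-mono (λ e∈ → eA′⊆A (there e∈)) (λ e∈ → e∈) A#B) s∉A′ s∉B

    extend : Reaches g s t → EdgeDisjointWalks s′ t → EdgeDisjointWalks s t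
    extend R (A , B , A#B) with s ∈ᵛ? verticesW G A | s ∈ᵛ? verticesW G B
    ... | yes s∈A | yes s∈B = let A′ , A′⊆A , _ = suffix A s∈A
                                  B′ , B′⊆B , _ = suffix B s∈B
                              in A′ , B′ , EdgeDisjointList-mono A′⊆A B′⊆B A#B
    ... | yes s∈A | no s∉B = extend-visiting-one R A B A#B s∈A s∉B
    ... | no s∉A | yes s∈B = extend-visiting-one R B A (EdgeDisjointList-sym A#B) s∈B s∉A
    ... | no s∉A | no s∉B = extend-avoiding R A B A#B s∉A s∉B

  Reaches-after-first-edge : ∀ {s s′ t g} → Joins G g s s′ → (Q : Walk G s′ t) → s ∉ₗ verticesW G Q →
    (∀ h → Reaches h s t) → ∀ h → Reaches h s′ t
  Reaches-after-first-edge {g = g} j Q s∉Q R h with h ≟ g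
  ... | yes refl = Q , λ h∈Q → s∉Q (incident⇒∈verticesW Q h∈Q (joins⇒incident j))
  ... | no h≢g = Reaches-trans (edge⇒Reaches (joins-sym j) (λ g≡h → h≢g (sym g≡h))) (R h)

  path⇒EdgeDisjointWalks : ∀ {s t} (Q : Walk G s t) → Unique (verticesW G Q) → (∀ h → Reaches h s t) →
    EdgeDisjointWalks s t
  path⇒EdgeDisjointWalks [ t ] _ _ = [ t ] , [ t ] , λ _ ()
  path⇒EdgeDisjointWalks (step g j Q) U R =
    extend j (R g) (path⇒EdgeDisjointWalks Q (tail U) (Reaches-after-first-edge j Q (Unique[x∷xs]⇒x∉xs U) R))

  two-edge-disjoint-paths : ∀ {s t} → Walk G s t → (∀ h → Reaches h s t) →
    Σ (Path G s t) λ P → Σ (Path G s t) λ Q → EdgeDisjointList G (edges G P) (edges G Q)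
  two-edge-disjoint-paths W R =
    let path Q U , _ = walk⇒path W
        A , B , A#B = path⇒EdgeDisjointWalks Q U R
        P , P⊆A = walk⇒path A
        P′ , P′⊆B = walk⇒path B
    in P , P′ , EdgeDisjointList-mono P⊆A P′⊆B A#B

  incident-edge-≢ : ∀ {v} → 2 ≤ degree G v → ∀ h → ∃ λ e → e ≢ h × Incident G e v
  incident-edge-≢ {v} 2≤deg h =
    let e , e∈ , e≢h = Unique-≥2⇒∃≢ _≟_ (filter⁺ incident? (allFin⁺ m)) 2≤deg h
    in e , e≢h , proj₂ (∈-filter⁻ incident? {xs = allFin m} e∈)
    where
    incident? : ∀ e → Dec (Incident G e v)
    incident? e = (proj₁ (ends e) ≟ v) ⊎-dec (proj₂ (ends e) ≟ v)

  Reaches-neighbour : ∀ {x b₁ b₂} → 2 ≤ degree G x → (∀ u → Adjacent G x u → u ≡ b₁ ⊎ u ≡ b₂) →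
    ∀ h → Reaches h x b₁ ⊎ Reaches h x b₂
  Reaches-neighbour {x} 2≤deg neighbours h =
    let e , e≢h , inc = incident-edge-≢ 2≤deg h
        u , j = incident⇒joins inc
        x⇝u = edge⇒Reaches j e≢h
    in map (λ u≡b₁ → subst (Reaches h x) u≡b₁ x⇝u) (λ u≡b₂ → subst (Reaches h x) u≡b₂ x⇝u)
           (neighbours u (e , j))

  outside-Reaches-neighbour : ∀ {h x b} (S : Subgraph G) → x ∉ V S → h ∈ E S → Adjacent G x b → Reaches h x b
  outside-Reaches-neighbour S x∉S h∈S (e , j) =
    edge⇒Reaches j λ e≡h → x∉S (incident⇒∈V S (subst (_∈ E S) (sym e≡h) h∈S) (joins⇒incident j))

  Connected⇒Reaches : ∀ {S h u v} → Connected G S → h ∉ E S → u ∈ V S → v ∈ V S → Reaches h u v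
  Connected⇒Reaches {h = h} (_ , paths) h∉S u∈S v∈S =
    let P , P⊆S = paths _ _ u∈S v∈S in Path.walk P , λ h∈P → h∉S (P⊆S h h∈P)

  ReachesAll : Edge G → Vertex G → Subset n → Set
  ReachesAll h x A = ∀ {z} → z ∈ A → Reaches h x z

  Reaches⇒ReachesAll : ∀ {h x u} (S : Subgraph G) → Connected G S → h ∉ E S → u ∈ V S →
    Reaches h x u → ReachesAll h x (V S)
  Reaches⇒ReachesAll S conn h∉S u∈S x⇝u z∈S = Reaches-trans x⇝u (Connected⇒Reaches {S} conn h∉S u∈S z∈S)

  ReachesAll-∩ : ∀ {h x} (S T : Subgraph G) → EdgeDisjointSub G S T →
    (h ∉ E S → ReachesAll h x (V S)) → (h ∉ E T → ReachesAll h x (V T)) → ReachesAll h x (V S ∩ V T)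
  ReachesAll-∩ {h} S T S#T viaS viaT z∈S∩T with h ∈ˢ? E S
  ... | yes h∈S = viaT (λ h∈T → S#T (h , x∈p∩q⁺ (h∈S , h∈T))) (proj₂ (x∈p∩q⁻ (V S) (V T) z∈S∩T))
  ... | no h∉S = viaS h∉S (proj₁ (x∈p∩q⁻ (V S) (V T) z∈S∩T))

  Between⇒Reaches : ∀ {h x y A B} (L : SomePath G) → h ∉ₗ edgesS G L → Between G L A B →
    ReachesAll h x A → ReachesAll h y B → Reaches h x y
  Between⇒Reaches L h∉L (inj₁ (start∈A , end∈B)) x⇝A y⇝B =
    Reaches-trans (Reaches-trans (x⇝A start∈A) (Path.walk (thePath L) , h∉L)) (Reaches-sym (y⇝B end∈B))
  Between⇒Reaches L h∉L (inj₂ (start∈B , end∈A)) x⇝A y⇝B =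
    Reaches-trans (Reaches-trans (x⇝A end∈A) (Reaches-sym (Path.walk (thePath L) , h∉L)))
      (Reaches-sym (y⇝B start∈B))

  Between-either⇒Reaches : ∀ {h x y A B} (L L′ : SomePath G) → EdgeDisjointList G (edgesS G L) (edgesS G L′) →
    Between G L A B → Between G L′ A B → ReachesAll h x A → ReachesAll h y B → Reaches h x y
  Between-either⇒Reaches {h} L L′ L#L′ L-between L′-between x⇝A y⇝B with h ∈ᵉ? edgesS G L
  ... | yes h∈L = Between⇒Reaches L′ (L#L′ h h∈L) L′-between x⇝A y⇝B
  ... | no h∉L = Between⇒Reaches L h∉L L-between x⇝A y⇝B

  module Attached {x b₁ b₂ a₁ a₂ z : Vertex G} (near far : Subgraph G)
    (near-connected : Connected G near) (far-connected : Connected G far)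
    (z∈near : z ∈ V near) (z∈far : z ∈ V far)
    (b₁∈near : b₁ ∈ V near) (b₂∈near : b₂ ∈ V near) (a₁∈far : a₁ ∈ V far) (a₂∈far : a₂ ∈ V far)
    (P₁ : Walk G b₁ a₁) (P₂ : Walk G b₂ a₂) (P₁#P₂ : EdgeDisjointList G (edgesW G P₁) (edgesW G P₂))
    (x∉near : x ∉ V near) (2≤deg : 2 ≤ degree G x) (neighbours : ∀ u → Adjacent G x u → u ≡ b₁ ⊎ u ≡ b₂)
    (x~b₁ : Adjacent G x b₁) (x~b₂ : Adjacent G x b₂) (h : Edge G) where

    ReachesAll-near : h ∉ E near → ReachesAll h x (V near)
    ReachesAll-near h∉near =
      [ Reaches⇒ReachesAll near near-connected h∉near b₁∈near
      , Reaches⇒ReachesAll near near-connected h∉near b₂∈near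
      ]′ (Reaches-neighbour 2≤deg neighbours h)

    ReachesAll-far : h ∉ E far → ReachesAll h x (V far)
    ReachesAll-far h∉far with h ∈ˢ? E near | h ∈ᵉ? edgesW G P₁
    ... | no h∉near | _ = Reaches⇒ReachesAll far far-connected h∉far z∈far (ReachesAll-near h∉near z∈near)
    ... | yes h∈near | no h∉P₁ = Reaches⇒ReachesAll far far-connected h∉far a₁∈far
      (Reaches-trans (outside-Reaches-neighbour near x∉near h∈near x~b₁) (P₁ , h∉P₁))
    ... | yes h∈near | yes h∈P₁ = Reaches⇒ReachesAll far far-connected h∉far a₂∈far
      (Reaches-trans (outside-Reaches-neighbour near x∉near h∈near x~b₂) (P₂ , P₁#P₂ h h∈P₁))

  crossing-avoids-one-side : (G₁ G₂ G₃ G₄ : Subgraph G) (L₃ L₄ : SomePath G) →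
    EdgeDisjointSub G G₁ G₂ → EdgeDisjointSub G G₁ G₃ → EdgeDisjointSub G G₂ G₄ → EdgeDisjointSub G G₃ G₄ →
    EdgeDisjointList G (edgesS G L₃) (edgesS G L₄) →
    (∀ e → e ∈ₗ edgesS G L₃ → e ∉ E G₁ ∪ E G₂ ∪ E G₃ ∪ E G₄) →
    (∀ e → e ∈ₗ edgesS G L₄ → e ∉ E G₁ ∪ E G₂ ∪ E G₃ ∪ E G₄) →
    ∀ h → (h ∉ E G₁ × h ∉ E G₄ × h ∉ₗ edgesS G L₃) ⊎ (h ∉ E G₂ × h ∉ E G₃ × h ∉ₗ edgesS G L₄)
  crossing-avoids-one-side G₁ G₂ G₃ G₄ L₃ L₄ G₁#G₂ G₁#G₃ G₂#G₄ G₃#G₄ L₃#L₄ L₃-off L₄-off h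
    with h ∈ᵉ? edgesS G L₃ | h ∈ˢ? E G₁ | h ∈ˢ? E G₄
  ... | yes h∈L₃ | _ | _ =
    let _ , h∉G₂ , h∉G₃ , _ = ∉-∪₄⁻ (L₃-off h h∈L₃) in inj₂ (h∉G₂ , h∉G₃ , L₃#L₄ h h∈L₃)
  ... | no _ | yes h∈G₁ | _ =
    inj₂ ( (λ h∈G₂ → G₁#G₂ (h , x∈p∩q⁺ (h∈G₁ , h∈G₂)))
         , (λ h∈G₃ → G₁#G₃ (h , x∈p∩q⁺ (h∈G₁ , h∈G₃)))
         , λ h∈L₄ → proj₁ (∉-∪₄⁻ (L₄-off h h∈L₄)) h∈G₁ )
  ... | no _ | no _ | yes h∈G₄ =
    inj₂ ( (λ h∈G₂ → G₂#G₄ (h , x∈p∩q⁺ (h∈G₂ , h∈G₄)))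
         , (λ h∈G₃ → G₃#G₄ (h , x∈p∩q⁺ (h∈G₃ , h∈G₄)))
         , λ h∈L₄ → proj₂ (proj₂ (proj₂ (∉-∪₄⁻ (L₄-off h h∈L₄)))) h∈G₄ )
  ... | no h∉L₃ | no h∉G₁ | no h∉G₄ = inj₁ (h∉G₁ , h∉G₄ , h∉L₃)

lemma7p3 : (G : Graph) (G₁ G₂ G₃ G₄ : Subgraph G) →
  Connected G G₁ → Connected G G₂ → Connected G G₃ → Connected G G₄ →
  EdgeDisjointSub G G₁ G₂ → EdgeDisjointSub G G₁ G₃ → EdgeDisjointSub G G₁ G₄ →
  EdgeDisjointSub G G₂ G₃ → EdgeDisjointSub G G₂ G₄ → EdgeDisjointSub G G₃ G₄ →
  -- H = G₁ ∪ G₂ and K = G₃ ∪ G₄ are (vertex-)disjoint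
  Empty ((V G₁ ∪ V G₂) ∩ (V G₃ ∪ V G₄)) →
  Nonempty (V G₁ ∩ V G₂) → Nonempty (V G₃ ∩ V G₄) →
  (a₁ a₂ b₁ b₂ c₁ c₂ d₁ d₂ : Vertex G) →
  a₁ ∈ V G₁ ─ V G₂ → a₂ ∈ V G₁ ─ V G₂ →
  b₁ ∈ V G₂ ─ V G₁ → b₂ ∈ V G₂ ─ V G₁ →
  c₁ ∈ V G₃ ─ V G₄ → c₂ ∈ V G₃ ─ V G₄ →
  d₁ ∈ V G₄ ─ V G₃ → d₂ ∈ V G₄ ─ V G₃ →
  (L₁ᵃ : Path G a₁ b₁) (L₂ᵃ : Path G a₂ b₂)
  (L₁ᶜ : Path G c₁ d₁) (L₂ᶜ : Path G c₂ d₂)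
  (L₃ L₄ : SomePath G) →
  -- the six paths are pairwise edge-disjoint
  EdgeDisjointList G (edges G L₁ᵃ) (edges G L₂ᵃ) →
  EdgeDisjointList G (edges G L₁ᵃ) (edges G L₁ᶜ) →
  EdgeDisjointList G (edges G L₁ᵃ) (edges G L₂ᶜ) →
  EdgeDisjointList G (edges G L₁ᵃ) (edgesS G L₃) →
  EdgeDisjointList G (edges G L₁ᵃ) (edgesS G L₄) →
  EdgeDisjointList G (edges G L₂ᵃ) (edges G L₁ᶜ) →
  EdgeDisjointList G (edges G L₂ᵃ) (edges G L₂ᶜ) →
  EdgeDisjointList G (edges G L₂ᵃ) (edgesS G L₃) →
  EdgeDisjointList G (edges G L₂ᵃ) (edgesS G L₄) →
  EdgeDisjointList G (edges G L₁ᶜ) (edges G L₂ᶜ) →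
  EdgeDisjointList G (edges G L₁ᶜ) (edgesS G L₃) →
  EdgeDisjointList G (edges G L₁ᶜ) (edgesS G L₄) →
  EdgeDisjointList G (edges G L₂ᶜ) (edgesS G L₃) →
  EdgeDisjointList G (edges G L₂ᶜ) (edgesS G L₄) →
  EdgeDisjointList G (edgesS G L₃) (edgesS G L₄) →
  -- alternative (a) or (b)
  ((Between G L₃ (V G₁ ∩ V G₂) (V G₃ ∩ V G₄) × Between G L₄ (V G₁ ∩ V G₂) (V G₃ ∩ V G₄))
   ⊎ (Between G L₃ (V G₁) (V G₄) × Between G L₄ (V G₂) (V G₃)
      × (∀ e → e ∈ₗ edgesS G L₃ → e ∉ E G₁ ∪ E G₂ ∪ E G₃ ∪ E G₄)
      × (∀ e → e ∈ₗ edgesS G L₄ → e ∉ E G₁ ∪ E G₂ ∪ E G₃ ∪ E G₄))) →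
  (x y : Vertex G) →
  -- x, y lie in no Gᵢ and on none of the six paths
  x ∉ V G₁ ∪ V G₂ ∪ V G₃ ∪ V G₄ → y ∉ V G₁ ∪ V G₂ ∪ V G₃ ∪ V G₄ →
  x ∉ₗ vertices G L₁ᵃ → x ∉ₗ vertices G L₂ᵃ → x ∉ₗ vertices G L₁ᶜ →
  x ∉ₗ vertices G L₂ᶜ → x ∉ₗ verticesS G L₃ → x ∉ₗ verticesS G L₄ →
  y ∉ₗ vertices G L₁ᵃ → y ∉ₗ vertices G L₂ᵃ → y ∉ₗ vertices G L₁ᶜ →
  y ∉ₗ vertices G L₂ᶜ → y ∉ₗ verticesS G L₃ → y ∉ₗ verticesS G L₄ →
  -- degree two, with the prescribed neighbours
  degree G x ≡ 2 → degree G y ≡ 2 →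
  (∀ u → Adjacent G x u → u ≡ b₁ ⊎ u ≡ b₂) → Adjacent G x b₁ → Adjacent G x b₂ →
  (∀ u → Adjacent G y u → u ≡ c₁ ⊎ u ≡ c₂) → Adjacent G y c₁ → Adjacent G y c₂ →
  -- conclusion: two edge-disjoint xy-paths
  Σ (Path G x y) λ P → Σ (Path G x y) λ Q → EdgeDisjointList G (edges G P) (edges G Q)
lemma7p3 G G₁ G₂ G₃ G₄ conn₁ conn₂ conn₃ conn₄ G₁#G₂ G₁#G₃ _ _ G₂#G₄ G₃#G₄ _ (z , z∈G₁∩G₂) (w , w∈G₃∩G₄)
  a₁ a₂ b₁ b₂ c₁ c₂ d₁ d₂ a₁∈ a₂∈ b₁∈ b₂∈ c₁∈ c₂∈ d₁∈ d₂∈ L₁ᵃ L₂ᵃ L₁ᶜ L₂ᶜ L₃ L₄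
  L₁ᵃ#L₂ᵃ _ _ _ _ _ _ _ _ L₁ᶜ#L₂ᶜ _ _ _ _ L₃#L₄ alternative x y x∉Gᵢ y∉Gᵢ
  _ _ _ _ _ _ _ _ _ _ _ _ deg-x deg-y x-neighbours x~b₁ x~b₂ y-neighbours y~c₁ y~c₂ =
  two-edge-disjoint-paths G (proj₁ (x⇝y (proj₁ x~b₁))) x⇝y
  where
  module X = Attached G G₂ G₁ conn₂ conn₁
    (proj₂ (x∈p∩q⁻ (V G₁) (V G₂) z∈G₁∩G₂)) (proj₁ (x∈p∩q⁻ (V G₁) (V G₂) z∈G₁∩G₂))
    (p─q⊆p (V G₂) (V G₁) b₁∈) (p─q⊆p (V G₂) (V G₁) b₂∈) (p─q⊆p (V G₁) (V G₂) a₁∈) (p─q⊆p (V G₁) (V G₂) a₂∈)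
    (reverseʷ G (Path.walk L₁ᵃ)) (reverseʷ G (Path.walk L₂ᵃ))
    (EdgeDisjointList-mono G (edgesW-reverseʷ G (Path.walk L₁ᵃ)) (edgesW-reverseʷ G (Path.walk L₂ᵃ)) L₁ᵃ#L₂ᵃ)
    (proj₁ (proj₂ (∉-∪₄⁻ x∉Gᵢ))) (≤-reflexive (sym deg-x)) x-neighbours x~b₁ x~b₂
  module Y = Attached G G₃ G₄ conn₃ conn₄
    (proj₁ (x∈p∩q⁻ (V G₃) (V G₄) w∈G₃∩G₄)) (proj₂ (x∈p∩q⁻ (V G₃) (V G₄) w∈G₃∩G₄))
    (p─q⊆p (V G₃) (V G₄) c₁∈) (p─q⊆p (V G₃) (V G₄) c₂∈) (p─q⊆p (V G₄) (V G₃) d₁∈) (p─q⊆p (V G₄) (V G₃) d₂∈)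
    (Path.walk L₁ᶜ) (Path.walk L₂ᶜ) L₁ᶜ#L₂ᶜ
    (proj₁ (proj₂ (proj₂ (∉-∪₄⁻ y∉Gᵢ)))) (≤-reflexive (sym deg-y)) y-neighbours y~c₁ y~c₂

  x⇝y : ∀ h → Reaches G h x y
  x⇝y h =
    [ (λ (L₃-between , L₄-between) →
        Between-either⇒Reaches G L₃ L₄ L₃#L₄ L₃-between L₄-between
          (ReachesAll-∩ G G₁ G₂ G₁#G₂ (X.ReachesAll-far h) (X.ReachesAll-near h))
          (ReachesAll-∩ G G₃ G₄ G₃#G₄ (Y.ReachesAll-near h) (Y.ReachesAll-far h)))
    , (λ (L₃-between , L₄-between , L₃-off , L₄-off) →
        [ (λ (h∉G₁ , h∉G₄ , h∉L₃) →
            Between⇒Reaches G L₃ h∉L₃ L₃-between (X.ReachesAll-far h h∉G₁) (Y.ReachesAll-far h h∉G₄))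
        , (λ (h∉G₂ , h∉G₃ , h∉L₄) →
            Between⇒Reaches G L₄ h∉L₄ L₄-between (X.ReachesAll-near h h∉G₂) (Y.ReachesAll-near h h∉G₃))
        ]′ (crossing-avoids-one-side G G₁ G₂ G₃ G₄ L₃ L₄ G₁#G₂ G₁#G₃ G₂#G₄ G₃#G₄ L₃#L₄ L₃-off L₄-off h))
    ]′ alternative
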